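{- Under the standing assumptions below, let $A\subseteq V_G$ be strongly compressed and let $B_1<B_2$ be blocks of $G$ that share a bone. Let $\mathrm{Stack}_G(\alpha)$ be a stack (in some direction) containing $B_2$, and let $B_3\subseteq\mathrm{Stack}_G(\alpha)$ be a block with $B_2<B_3$. If $B_1\not\subseteq A$ and $B_2\cap A\ne\emptyset$, then $B_3\cap A=\emptyset$.
   Context: All graphs are finite and simple. For $G=(V,E)$, $I_G(A,B)$ is the set of edges with one end in $A$ and the other in $B$, $I_G(A)=I_G(A,A)$, $I_G(m)=\max_{|S|=m}|I_G(S)|$. A total order is a bijection $\mathcal O:V\to\{1,\dots,|V|\}$, $\mathcal O[k,l]=\mathcal O^{ -1}(\{k,\dots,l\})$; it is optimal if $|I_G(\mathcal O[1,k])|=I_G(k)$ for all $k$; $G$ is isoperimetric if it has one. $\delta_G(1)=0$, $\delta_G(m)=I_G(m)-I_G(m-1)$. Cartesian product $G_1\square\cdots\square G_d$: tuples adjacent iff they differ in exactly one coordinate, where they are adjacent. Lexicographic order on $\mathbb R^k$: $x<y$ iff for some $i$, $x_1=y_1,\dots,x_i=y_i$, $x_{i+1}<y_{i+1}$. For $\pi\in\mathfrak S_k$, $\mathcal D^{\pi,k}$ compares $(x_{\pi(1)},\dots,x_{\pi(k)})$ lexicographically; orders on $\mathbb R^k$ induce orders on products of ordered sets via rank tuples. Isoperimetric partition of isoperimetric $G$ with optimal $\mathcal O_G$: partition into consecutive intervals $\mathcal O_G[a_i,b_i]$ such that each part induces an isoperimetric subgraph with the restricted order optimal, and every $v\in\mathcal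 O_G[a_i,b_i]$ has exactly $\delta_G(a_i)$ neighbours in $\mathcal O_G[a_1,b_{i-1}]$. Starts of parts are their first vertices; $\mathfrak T_G$ is the set of starts. Non-decreasing: each part's induced subgraph has non-decreasing $\delta$-sequence. Regular: first and last parts' induced subgraphs have equal $\delta$-sequences. Setup: $G_i$ ($1\le i\le d$) isoperimetric with fixed optimal orders $\mathcal O_{G_i}$ and isoperimetric partitions $\mathfrak P_{G_i}$; $G=G_1\square\cdots\square G_d$; $G_S=G_{i_1}\square\cdots\square G_{i_k}$ for $S=\{i_1<\dots<i_k\}$. Blocks of $G_S$: $Z_{i_1}\times\cdots\times Z_{i_k}$, $Z_{i_j}\in\mathfrak P_{G_{i_j}}$; start: tuple of starts. An order $\mathcal O$ on a product is consistent with an order $\mathcal O'$ on the subproduct over $S$ if $x<_{\mathcal O}y$ and $x_j=y_j$ for $j\notin S$ imply the same inequality of projections in $\mathcal O'$. Domination collection: each block $B$ of each $G_S$ has $\pi_B\in\mathfrak S_{|S|}$ such that the order $\mathcal D_B$ induced by $\mathcal D^{\pi_B,|S|}$ on $B$ (coordinates ranked by restrictions of $\mathcal O_{G_{i_j}}$) is optimal for the subgraph induced by $B$, and for $S_1\subset S_2$, $\mathcal D_{B_2}$ is consistent with $\mathcal D_{B_1}$ when $B_1$ consists of the factors of $B_2$ indexed by $S_1$. $\mathcal{BL}^k_{G_S}$: same block: compare by $\mathcal D_B$; different blocks: compare starts lexicographically; $\mathcal{BL}^d_G=\mathcal{BL}^d_{G_{\{1,\dots,d\}}}$. Regular domination collection: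 $\mathfrak P_{G_i}$ regular for $2\le i\le d-1$, and $\pi_{B_1}=\pi_{B_2}$ for $B_1$ (resp. $B_2$) the product of the first (resp. last) parts of $\mathfrak P_{G_2},\dots,\mathfrak P_{G_{d-1}}$. Standing assumptions: $d\ge3$; the $\mathfrak P_{G_i}$ form a regular domination collection; $\mathfrak P_{G_i}$ non-decreasing for $i\le d-1$; $\mathcal{BL}^2_{G_i\square G_j}$ optimal for all $i<j$. Compression: for nonempty proper $S$ with an order on $G_S$, and $x\in V_{G_{\overline S}}$, the section $G_S(x)$ is the set of vertices of $G$ with $\overline S$-coordinates equal to $x$, ordered via its isomorphism with $G_S$; compression replaces each $A\cap G_S(x)$ by the initial segment of $G_S(x)$ of the same size. $A$ is strongly compressed if it is unchanged by compression for every nonempty proper $S$ with respect to $\mathcal{BL}^{|S|}_{G_S}$. Geometry: blocks of $G$ are ordered by $\mathcal{BL}^d_G$ of their starts. Distinct blocks $Z_1\times\cdots\times Z_d$ and $Y_1\times\cdots\times Y_d$ share the $i$-th bone if $Y_i=Z_i$; they share a bone if this holds for some $i$. For $\sigma\in\mathfrak T_{G_1}\times\cdots\times\mathfrak T_{G_{i-1}}$, $\tau\in\mathfrak T_{G_{i+1}}\times\cdots\times\mathfrak T_{G_d}$, the stack in direction $i$ at $\alpha=(\sigma,i,\tau)$, $\mathrm{Stack}_G(\alpha)$, is the union over $s\in\mathfrak T_{G_i}$ of the blocks with start $(\sigma,s,\tau)$. -}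

module Defs where

open import Data.Nat using (ℕ; zero; suc; _+_; _∸_; _≤_; _<_; _⊔_; _<ᵇ_; _≡ᵇ_)
open import Data.Bool using (Bool; true; false; _∧_; _∨_; not; if_then_else_)
open import Data.List using (List; []; _∷_; _++_; length; map; concat; filterᵇ; upTo; allFin;
  cartesianProductWith; zip; zipWith; foldr; head; last; drop)
open import Data.List.Properties using (≡-dec)
open import Data.List.Membership.Propositional using (_∈_)
open import Data.List.Relation.Unary.All using (All)
open import Data.List.Relation.Binary.Pointwise using (Pointwise)
open import Data.List.Relation.Binary.Permutation.Propositional using (_↭_)
open import Data.Maybe using (Maybe; just; nothing)
import Data.Maybe as Maybe
open import Data.Fin using (Fin; toℕ)
import Data.Fin as Fin
open import Data.Fin.Permutation using (Permutation′; _⟨$⟩ʳ_; _≈_)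
open import Data.Product using (_×_; Σ; ∃; proj₁; proj₂; _,_)
open import Data.Sum using (_⊎_)
open import Data.Unit using (⊤)
open import Relation.Nullary using (¬_; does)
open import Relation.Binary.PropositionalEquality using (_≡_; _≢_)
import Data.Nat as ℕ

-- Generic finite graphs: a vertex type V, a Boolean adjacency relation,
-- and a vertex set given as a duplicate-free list of vertices.

countᵇ : {A : Set} → (A → Bool) → List A → ℕ
countᵇ p xs = length (filterᵇ p xs)

edges : {V : Set} → (V → V → Bool) → List V → ℕ
edges adj []       = 0
edges adj (x ∷ xs) = countᵇ (adj x) xs + edges adj xs

sublists : {V : Set} → List V → List (List V)
sublists []       = [] ∷ []
sublists (x ∷ xs) = map (x ∷_) (sublists xs) ++ sublists xs

Imax : {V : Set} → (V → V → Bool) → List V → ℕ → ℕ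
Imax adj vs m =
  foldr _⊔_ 0 (map (edges adj) (filterᵇ (λ s → length s ≡ᵇ m) (sublists vs)))

-- δ_G(1) = 0, δ_G(m) = I_G(m) - I_G(m-1)   (δ 0 is unused; set to 0)
δ : {V : Set} → (V → V → Bool) → List V → ℕ → ℕ
δ adj vs zero          = 0
δ adj vs (suc zero)    = 0
δ adj vs (suc (suc m)) = Imax adj vs (suc (suc m)) ∸ Imax adj vs (suc m)

δseq : {V : Set} → (V → V → Bool) → List V → List ℕ
δseq adj vs = map (λ m → δ adj vs (suc m)) (upTo (length vs))

IsStrictTotalOn : {V : Set} → (V → V → Bool) → List V → Set
IsStrictTotalOn {V} lt vs =
  (∀ {u : V} → u ∈ vs → lt u u ≡ false)
  × (∀ {u v w : V} → u ∈ vs → v ∈ vs → w ∈ vs →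
       lt u v ≡ true → lt v w ≡ true → lt u w ≡ true)
  × (∀ {u v : V} → u ∈ vs → v ∈ vs → u ≢ v → (lt u v ≡ true) ⊎ (lt v u ≡ true))

-- O[1,k] : the vertices of vs of rank ≤ k (rank counted from 1)
initSeg : {V : Set} → (V → V → Bool) → List V → ℕ → List V
initSeg lt vs k = filterᵇ (λ v → countᵇ (λ u → lt u v) vs <ᵇ k) vs

Optimal : {V : Set} → (V → V → Bool) → List V → (V → V → Bool) → Set
Optimal adj vs lt =
  IsStrictTotalOn lt vs × (∀ k → k ≤ length vs → edges adj (initSeg lt vs k) ≡ Imax adj vs k)

-- Orders on factors given as lists (position 0 = first vertex)

indexOf : List ℕ → ℕ → ℕ
indexOf []       x = 0
indexOf (y ∷ ys) x = if y ≡ᵇ x then 0 else suc (indexOf ys x)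

posLt : List ℕ → ℕ → ℕ → Bool
posLt ord x y = indexOf ord x <ᵇ indexOf ord y

headD : List ℕ → ℕ
headD []      = 0
headD (x ∷ _) = x

NonEmpty : {A : Set} → List A → Set
NonEmpty xs = 0 < length xs

-- Conditions on the parts of an isoperimetric partition; pre = union
-- of the previous parts, so the current part starts at a = |pre| + 1.
PartsOK : (ℕ → ℕ → Bool) → List ℕ → List ℕ → List ℕ → List (List ℕ) → Set
PartsOK adj vs ord pre []       = ⊤
PartsOK adj vs ord pre (P ∷ Ps) =
  (Optimal adj P (posLt ord)
   × (∀ {v} → v ∈ P → countᵇ (adj v) pre ≡ δ adj vs (suc (length pre))))
  × PartsOK adj vs ord (pre ++ P) Ps

IsoPartition : (ℕ → ℕ → Bool) → List ℕ → List ℕ → List (List ℕ) → Set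
IsoPartition adj vs ord parts =
  concat parts ≡ ord × All NonEmpty parts × PartsOK adj vs ord [] parts

record Factor : Set where
  field
    n          : ℕ
    adj        : ℕ → ℕ → Bool
    adj-sym    : ∀ x y → adj x y ≡ adj y x
    adj-irr    : ∀ x → adj x x ≡ false
    ord        : List ℕ
    ord-perm   : ord ↭ upTo n
    ord-opt    : Optimal adj (upTo n) (posLt ord)
    parts      : List (List ℕ)
    parts-iso  : IsoPartition adj (upTo n) ord parts

open Factor public

starts : Factor → List ℕ
starts F = map headD (parts F)

NonDecreasing : Factor → Set
NonDecreasing F = ∀ {P} → P ∈ parts F → ∀ m → 1 ≤ m → suc m ≤ length P →
  δ (adj F) P m ≤ δ (adj F) P (suc m)

Regular : Factor → Set
Regular F = Maybe.map (δseq (adj F)) (head (parts F)) ≡ Maybe.map (δseq (adj F)) (last (parts F))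

cart : {A : Set} → List (List A) → List (List A)
cart []       = [] ∷ []
cart (Z ∷ Zs) = cartesianProductWith _∷_ Z (cart Zs)

eqL : List ℕ → List ℕ → Bool
eqL xs ys = does (≡-dec ℕ._≟_ xs ys)

lexLt : List ℕ → List ℕ → Bool
lexLt (x ∷ xs) (y ∷ ys) = (x <ᵇ y) ∨ ((x ≡ᵇ y) ∧ lexLt xs ys)
lexLt _        _        = false

nthD : List ℕ → ℕ → ℕ
nthD []       _       = 0
nthD (x ∷ _)  zero    = x
nthD (_ ∷ xs) (suc k) = nthD xs k

_at_ : {A : Set} → List A → ℕ → Maybe A
[]       at _     = nothing
(x ∷ _)  at zero  = just x
(_ ∷ xs) at suc k = xs at k

memᵇ : ℕ → List ℕ → Bool
memᵇ x []       = false
memᵇ x (y ∷ ys) = (y ≡ᵇ x) ∨ memᵇ x ys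

partOf : List (List ℕ) → ℕ → List ℕ
partOf []       x = []
partOf (P ∷ Ps) x = if memᵇ x P then P else partOf Ps x

-- Products G = G_0 □ ... □ G_{d-1}  (paper's G_1,...,G_d, 0-indexed)

module Prod {d : ℕ} (G : Fin d → Factor) where

  Sub : Set
  Sub = Fin d → Bool

  full : Sub
  full _ = true

  idx : Sub → List (Fin d)
  idx S = filterᵇ S (allFin d)

  _⊆ˢ_ : Sub → Sub → Set
  S₁ ⊆ˢ S₂ = ∀ i → S₁ i ≡ true → S₂ i ≡ true

  NonemptyProper : Sub → Set
  NonemptyProper S = (∃ λ i → S i ≡ true) × (∃ λ i → S i ≡ false)

  -- vertices of G_S (tuples indexed by idx S)
  verts : List (Fin d) → List (List ℕ)
  verts is = cart (map (λ i → upTo (n (G i))) is)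

  padj : List (Fin d) → List ℕ → List ℕ → Bool
  padj (i ∷ is) (x ∷ xs) (y ∷ ys) =
    ((x ≡ᵇ y) ∧ padj is xs ys) ∨ (adj (G i) x y ∧ eqL xs ys)
  padj _ _ _ = false

  IsBlock : List (Fin d) → List (List ℕ) → Set
  IsBlock is B = Pointwise (λ i Z → Z ∈ parts (G i)) is B

  start : List (List ℕ) → List ℕ
  start B = map headD B

  ranks : List (Fin d) → List ℕ → List ℕ
  ranks is x = zipWith (λ i xi → indexOf (ord (G i)) xi) is x

  blockOf : List (Fin d) → List ℕ → List (List ℕ)
  blockOf is x = zipWith (λ i xi → partOf (parts (G i)) xi) is x

  proj : {A : Set} → List (Fin d) → Sub → List A → List A
  proj is S' xs = map proj₂ (filterᵇ (λ p → S' (proj₁ p)) (zip is xs))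

  -- assignment B ↦ π_B ∈ 𝔖_{|S|} for blocks B of G_S
  DomMap : Set
  DomMap = (S : Sub) → List (List ℕ) → Permutation′ (length (idx S))

  key : (S : Sub) → Permutation′ (length (idx S)) → List ℕ → List ℕ
  key S p x = map (λ j → nthD (ranks (idx S) x) (toℕ (p ⟨$⟩ʳ j))) (allFin (length (idx S)))

  Dlt : (S : Sub) → Permutation′ (length (idx S)) → List ℕ → List ℕ → Bool
  Dlt S p x y = lexLt (key S p x) (key S p y)

  BLlt : DomMap → (S : Sub) → List ℕ → List ℕ → Bool
  BLlt π S x y =
    if eqL (start (blockOf (idx S) x)) (start (blockOf (idx S) y))
    then Dlt S (π S (blockOf (idx S) x)) x y
    else lexLt (ranks (idx S) (start (blockOf (idx S) x)))
               (ranks (idx S) (start (blockOf (idx S) y)))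

  DominationCollection : DomMap → Set
  DominationCollection π =
    (∀ S B → IsBlock (idx S) B → Optimal (padj (idx S)) (cart B) (Dlt S (π S B)))
    × (∀ S₁ S₂ B₂ → S₁ ⊆ˢ S₂ → IsBlock (idx S₂) B₂ →
         ∀ {x y} → x ∈ cart B₂ → y ∈ cart B₂ →
         Dlt S₂ (π S₂ B₂) x y ≡ true →
         proj (idx S₂) (λ i → not (S₁ i)) x ≡ proj (idx S₂) (λ i → not (S₁ i)) y →
         Dlt S₁ (π S₁ (proj (idx S₂) S₁ B₂)) (proj (idx S₂) S₁ x) (proj (idx S₂) S₁ y) ≡ true)

  -- {2,...,d-1} in the paper's 1-based indexing
  Smid : Sub
  Smid i = (1 ℕ.≤ᵇ toℕ i) ∧ (toℕ i ℕ.≤ᵇ d ∸ 2)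

  lastD : List (List ℕ) → List ℕ
  lastD Ps = Maybe.fromMaybe [] (last Ps)

  firstD : List (List ℕ) → List ℕ
  firstD Ps = Maybe.fromMaybe [] (head Ps)

  RegularDomination : DomMap → Set
  RegularDomination π =
    DominationCollection π
    × (∀ i → 1 ≤ toℕ i → toℕ i ≤ d ∸ 2 → Regular (G i))
    × (π Smid (map (λ i → firstD (parts (G i))) (idx Smid))
         ≈ π Smid (map (λ i → lastD (parts (G i))) (idx Smid)))

  pair : Fin d → Fin d → Sub
  pair i j k = does (k Fin.≟ i) ∨ does (k Fin.≟ j)

  BL2Optimal : DomMap → Set
  BL2Optimal π = ∀ i j → i Fin.< j →
    Optimal (padj (idx (pair i j))) (verts (idx (pair i j))) (BLlt π (pair i j))

  merge : List (Fin d) → Sub → List ℕ → List ℕ → List ℕ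
  merge []       S ys xs = []
  merge (i ∷ is) S ys xs =
    if S i then headD ys ∷ merge is S (drop 1 ys) xs
           else headD xs ∷ merge is S ys (drop 1 xs)

  -- A is unchanged by compression along every nonempty proper S
  StronglyCompressed : DomMap → (List ℕ → Bool) → Set
  StronglyCompressed π A =
    ∀ S → NonemptyProper S →
    ∀ x → x ∈ verts (idx (λ i → not (S i))) →
    filterᵇ (λ y → A (merge (allFin d) S y x)) (verts (idx S))
      ≡ initSeg (BLlt π S) (verts (idx S))
          (length (filterᵇ (λ y → A (merge (allFin d) S y x)) (verts (idx S))))

  BlockLt : DomMap → List (List ℕ) → List (List ℕ) → Set
  BlockLt π B₁ B₂ = BLlt π full (start B₁) (start B₂) ≡ true

  ShareBone : List (List ℕ) → List (List ℕ) → Set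
  ShareBone B₁ B₂ = B₁ ≢ B₂ × ∃ λ (i : Fin d) → B₁ at toℕ i ≡ B₂ at toℕ i

  lowIdx highIdx : Fin d → List (Fin d)
  lowIdx i  = filterᵇ (λ j → toℕ j <ᵇ toℕ i) (allFin d)
  highIdx i = filterᵇ (λ j → toℕ i <ᵇ toℕ j) (allFin d)

  StackIndex : Fin d → List ℕ → List ℕ → Set
  StackIndex i σ τ =
    σ ∈ cart (map (λ j → starts (G j)) (lowIdx i))
    × τ ∈ cart (map (λ j → starts (G j)) (highIdx i))

  InStack : Fin d → List ℕ → List ℕ → List ℕ → Set
  InStack i σ τ v =
    ∃ λ B → IsBlock (idx full) B ×
      (∃ λ s → s ∈ starts (G i) × start B ≡ σ ++ s ∷ τ) × v ∈ cart B

module Submission where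

-- Strong compression makes A ∩ G_S(x) an initial segment of BL^{|S|}, and BL^{|S|} orders
-- vertices of different blocks lexicographically by the ranks of their block starts. So A is
-- closed under replacing a vertex, within a section, by one whose block starts are smaller on S.
-- Suppose v ∈ B₃ ∩ A and let w ∈ B₁. B₂ and B₃ lie in one stack, so their parts agree outside
-- the stack direction t; B₁ and B₂ have the same part at a shared bone i₀. Let z ∈ B₂ agree with
-- w at i₀ and with v outside {i₀, t}. Compressing along {i₀, t} (proper because d ≥ 3), B₂ < B₃
-- gives z ∈ A; compressing along all coordinates but i₀, B₁ < B₂ gives w ∈ A. Thus B₁ ⊆ A.

open import Defs
open import Data.Nat using (ℕ; _≤_)
open import Data.Bool using (Bool; true; false)
open import Data.List using (List)
open import Data.List.Membership.Propositional using (_∈_)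
open import Data.Fin using (Fin; toℕ)
open import Data.Product using (_×_; ∃)
open import Relation.Nullary using (¬_)
open import Relation.Binary.PropositionalEquality using (_≡_)
open import Data.Nat using (_∸_)

open import Data.Bool using (not; _∨_)
open import Data.Bool.Properties using (T-≡; T-not-≡; ∨-zeroʳ)
open import Data.Empty using (⊥; ⊥-elim)
open import Data.Fin using (zero; suc; _≟_; fromℕ<)
open import Data.Fin.Properties using (toℕ-injective; toℕ-fromℕ<)
open import Data.List using ([]; _∷_; _++_; length; map; concat; filterᵇ; tabulate; allFin; upTo)
open import Data.List.Properties
  using (≡-dec; filter-all; map-cong; map-cong-local; map-∘; map-tabulate; length-map; length-tabulate; length-++)
open import Data.List.Membership.Propositional.Properties
  using (∈-filter⁺; ∈-filter⁻; ∈-++⁺ʳ; ∈-concat⁺′; ∈-cartesianProductWith⁺; ∈-cartesianProductWith⁻)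
open import Data.List.Relation.Binary.Permutation.Propositional using (↭-sym; ↭⇒↭ₛ)
open import Data.List.Relation.Binary.Permutation.Propositional.Properties using (∈-resp-↭)
open import Data.List.Relation.Binary.Pointwise using (Pointwise; []; _∷_)
import Data.List.Relation.Unary.All as All
open import Data.List.Relation.Unary.All.Properties using (all-filter)
open import Data.List.Relation.Unary.AllPairs using (_∷_)
open import Data.List.Relation.Unary.Any using (here; there)
open import Data.List.Relation.Unary.Unique.Propositional using (Unique)
open import Data.List.Relation.Unary.Unique.Propositional.Properties using (upTo⁺)
open import Data.Maybe using (just)
open import Data.Maybe.Properties using (just-injective)
import Data.Nat as ℕ
open import Data.Nat using (zero; suc; _+_; _<_; z<s; _<ᵇ_; _≡ᵇ_; z≤n; s≤s)
open import Data.Nat.Properties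
  using (<ᵇ⇒<; <⇒<ᵇ; ≡ᵇ⇒≡; <-irrefl; <-trans; ≤-<-trans; m≤n⇒m≤1+n; m<m+n; module ≤-Reasoning)
open import Data.Product using (_,_; proj₁; proj₂)
open import Data.Sum using (_⊎_; inj₁; inj₂)
open import Function using (Equivalence; _∘_; id)
open import Relation.Binary.PropositionalEquality
  using (_≢_; refl; sym; trans; cong; cong₂; subst; subst₂; setoid; module ≡-Reasoning)
open import Data.List.Relation.Binary.Permutation.Setoid.Properties (setoid ℕ) using (Unique-resp-↭)
open import Relation.Nullary using (does; yes; no)
open import Relation.Nullary.Decidable using (T?; dec-true; dec-false)

<ᵇ-irrefl : ∀ x → (x <ᵇ x) ≡ false
<ᵇ-irrefl zero    = refl
<ᵇ-irrefl (suc x) = <ᵇ-irrefl x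

≡ᵇ-refl : ∀ x → (x ≡ᵇ x) ≡ true
≡ᵇ-refl zero    = refl
≡ᵇ-refl (suc x) = ≡ᵇ-refl x

lexLt-irrefl : ∀ xs → lexLt xs xs ≡ false
lexLt-irrefl []       = refl
lexLt-irrefl (x ∷ xs) rewrite <ᵇ-irrefl x | ≡ᵇ-refl x = lexLt-irrefl xs

lexLt⇒≢ : ∀ {xs ys} → lexLt xs ys ≡ true → xs ≢ ys
lexLt⇒≢ {xs} xs<xs refl with () ← trans (sym xs<xs) (lexLt-irrefl xs)

lexLt-head : ∀ x y xs ys → x < y → lexLt (x ∷ xs) (y ∷ ys) ≡ true
lexLt-head x y xs ys x<y rewrite Equivalence.to T-≡ (<⇒<ᵇ {x} {y} x<y) = refl

lexLt-tail : ∀ x xs ys → lexLt xs ys ≡ true → lexLt (x ∷ xs) (x ∷ ys) ≡ true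
lexLt-tail x xs ys xs<ys rewrite <ᵇ-irrefl x | ≡ᵇ-refl x = xs<ys

lexLt-∷⁻ : ∀ x y xs ys → lexLt (x ∷ xs) (y ∷ ys) ≡ true →
  x < y ⊎ (x ≡ y × lexLt xs ys ≡ true)
lexLt-∷⁻ x y xs ys lt with x <ᵇ y in x<ᵇy | x ≡ᵇ y in x≡ᵇy
... | true  | _    = inj₁ (<ᵇ⇒< x y (Equivalence.from T-≡ x<ᵇy))
... | false | true = inj₂ (≡ᵇ⇒≡ x y (Equivalence.from T-≡ x≡ᵇy) , lt)

lexLt-trans : ∀ xs ys zs → lexLt xs ys ≡ true → lexLt ys zs ≡ true → lexLt xs zs ≡ true
lexLt-trans (x ∷ xs) (y ∷ ys) (z ∷ zs) xs<ys ys<zs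
  with lexLt-∷⁻ x y xs ys xs<ys | lexLt-∷⁻ y z ys zs ys<zs
... | inj₁ x<y          | inj₁ y<z          = lexLt-head x z xs zs (<-trans x<y y<z)
... | inj₁ x<y          | inj₂ (refl , _)   = lexLt-head x z xs zs x<y
... | inj₂ (refl , _)   | inj₁ y<z          = lexLt-head x z xs zs y<z
... | inj₂ (refl , lt₁) | inj₂ (refl , lt₂) = lexLt-tail x xs zs (lexLt-trans xs ys zs lt₁ lt₂)

lexLt-filterᵇ : ∀ {I : Set} (S : I → Bool) (f g : I → ℕ) is →
  (∀ k → S k ≡ false → f k ≡ g k) →
  lexLt (map f is) (map g is) ≡ true →
  lexLt (map f (filterᵇ S is)) (map g (filterᵇ S is)) ≡ true
lexLt-filterᵇ S f g (k ∷ is) agree lt with S k in Sk | lexLt-∷⁻ (f k) (g k) (map f is) (map g is) lt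
... | true  | inj₁ fk<gk        = lexLt-head (f k) (g k) (map f (filterᵇ S is)) (map g (filterᵇ S is)) fk<gk
... | true  | inj₂ (fk≡gk , lt′) rewrite fk≡gk = lexLt-tail (g k) (map f (filterᵇ S is)) (map g (filterᵇ S is))
      (lexLt-filterᵇ S f g is agree lt′)
... | false | inj₁ fk<gk        = ⊥-elim (<-irrefl (agree k Sk) fk<gk)
... | false | inj₂ (_ , lt′)    = lexLt-filterᵇ S f g is agree lt′

countᵇ-mono : ∀ {A : Set} {p q : A → Bool} → (∀ u → p u ≡ true → q u ≡ true) →
  ∀ xs → countᵇ p xs ≤ countᵇ q xs
countᵇ-mono p⇒q [] = z≤n
countᵇ-mono {p = p} {q} p⇒q (x ∷ xs) with p x in px | q x in qx
... | true  | true  = s≤s (countᵇ-mono p⇒q xs)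
... | true  | false with () ← trans (sym (p⇒q x px)) qx
... | false | true  = m≤n⇒m≤1+n (countᵇ-mono p⇒q xs)
... | false | false = countᵇ-mono p⇒q xs

initSeg-downward : ∀ {V : Set} (lt : V → V → Bool) vs k {y y′ : V} →
  (∀ u → lt u y ≡ true → lt u y′ ≡ true) →
  y ∈ vs → y′ ∈ initSeg lt vs k → y ∈ initSeg lt vs k
initSeg-downward {V} lt vs k {y} {y′} below y∈vs y′∈seg =
  ∈-filter⁺ (T? ∘ inSeg) y∈vs
    (<⇒<ᵇ (≤-<-trans (countᵇ-mono below vs) (<ᵇ⇒< _ k (proj₂ (∈-filter⁻ (T? ∘ inSeg) {xs = vs} y′∈seg)))))
  where
  inSeg : V → Bool
  inSeg v = countᵇ (λ u → lt u v) vs <ᵇ k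

memᵇ-complete : ∀ {x Q} → x ∈ Q → memᵇ x Q ≡ true
memᵇ-complete {x} (here refl) rewrite ≡ᵇ-refl x = refl
memᵇ-complete {x} {y ∷ Q} (there x∈Q) rewrite memᵇ-complete x∈Q = ∨-zeroʳ (y ≡ᵇ x)

memᵇ-sound : ∀ {x} Q → memᵇ x Q ≡ true → x ∈ Q
memᵇ-sound {x} (y ∷ Q) mem with y ≡ᵇ x in y≡ᵇx
... | true  = here (sym (≡ᵇ⇒≡ y x (Equivalence.from T-≡ y≡ᵇx)))
... | false = there (memᵇ-sound Q mem)

Unique-++⁻ : ∀ {A : Set} xs {ys : List A} → Unique (xs ++ ys) →
  Unique ys × (∀ {x} → x ∈ xs → x ∈ ys → ⊥)
Unique-++⁻ []       u         = u , λ ()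
Unique-++⁻ (_ ∷ xs) (x∉ ∷ u) = proj₁ (Unique-++⁻ xs u) , disjoint
  where
  disjoint : ∀ {x} → x ∈ _ ∷ xs → x ∈ _ → ⊥
  disjoint (here refl)  x∈ys = All.lookup x∉ (∈-++⁺ʳ xs x∈ys) refl
  disjoint (there x∈xs) x∈ys = proj₂ (Unique-++⁻ xs u) x∈xs x∈ys

partOf-∈ : ∀ Ps {P x} → Unique (concat Ps) → P ∈ Ps → x ∈ P → partOf Ps x ≡ P
partOf-∈ (Q ∷ Ps) u (here refl) x∈Q rewrite memᵇ-complete x∈Q = refl
partOf-∈ (Q ∷ Ps) {x = x} u (there P∈Ps) x∈P with memᵇ x Q in x∈?Q
... | true  = ⊥-elim (proj₂ (Unique-++⁻ Q u) (memᵇ-sound Q x∈?Q) (∈-concat⁺′ x∈P P∈Ps))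
... | false = partOf-∈ Ps (proj₁ (Unique-++⁻ Q u)) P∈Ps x∈P

module _ (F : Factor) where

  parts-unique : Unique (concat (parts F))
  parts-unique = subst Unique (sym (proj₁ (parts-iso F)))
    (Unique-resp-↭ (↭⇒↭ₛ (↭-sym (ord-perm F))) (upTo⁺ (n F)))

  partOf-part : ∀ {P x} → P ∈ parts F → x ∈ P → partOf (parts F) x ≡ P
  partOf-part = partOf-∈ (parts F) parts-unique

  headD-∈-part : ∀ {P} → P ∈ parts F → headD P ∈ P
  headD-∈-part {x ∷ _} _    = here refl
  headD-∈-part {[]}    P∈Ps with () ← All.lookup (proj₁ (proj₂ (parts-iso F))) P∈Ps

  part-⊆-vertices : ∀ {P x} → P ∈ parts F → x ∈ P → x ∈ upTo (n F)
  part-⊆-vertices P∈Ps x∈P =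
    ∈-resp-↭ (ord-perm F) (subst (_ ∈_) (proj₁ (parts-iso F)) (∈-concat⁺′ x∈P P∈Ps))

map-∈-cart : ∀ {I A : Set} {F : I → List A} {h : I → A} → (∀ k → h k ∈ F k) →
  ∀ is → map h is ∈ cart (map F is)
map-∈-cart h∈F []       = here refl
map-∈-cart h∈F (k ∷ is) = ∈-cartesianProductWith⁺ _∷_ (h∈F k) (map-∈-cart h∈F is)

cart-tabulate⁻ : ∀ {A : Set} {m} (F : Fin m → List A) {v} → v ∈ cart (tabulate F) →
  ∃ λ h → v ≡ tabulate h × (∀ k → h k ∈ F k)
cart-tabulate⁻ {m = zero}  F (here refl) = (λ ()) , refl , λ ()
cart-tabulate⁻ {m = suc m} F v∈
  with x , xs , x∈ , xs∈ , refl ← ∈-cartesianProductWith⁻ _∷_ (F zero) (cart (tabulate (F ∘ suc))) v∈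
  with h , refl , h∈ ← cart-tabulate⁻ (F ∘ suc) xs∈
  = (λ { zero → x ; (suc k) → h k }) , refl , λ { zero → x∈ ; (suc k) → h∈ k }

Pointwise-tabulate⁻ : ∀ {A B : Set} {R : A → B → Set} {m} (f : Fin m → A) {ys} →
  Pointwise R (tabulate f) ys → ∃ λ g → ys ≡ tabulate g × (∀ k → R (f k) (g k))
Pointwise-tabulate⁻ {m = zero}  f []        = (λ ()) , refl , λ ()
Pointwise-tabulate⁻ {m = suc m} f (r ∷ rs)
  with g , refl , gR ← Pointwise-tabulate⁻ (f ∘ suc) rs
  = (λ { zero → _ ; (suc k) → g k }) , refl , λ { zero → r ; (suc k) → gR k }

at-tabulate : ∀ {A : Set} {m} (f : Fin m → A) k → tabulate f at toℕ k ≡ just (f k)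
at-tabulate f zero    = refl
at-tabulate f (suc k) = at-tabulate (f ∘ suc) k

at-++-∷ : ∀ {A : Set} (σ τ : List A) s s′ {m} → m ≢ length σ → (σ ++ s ∷ τ) at m ≡ (σ ++ s′ ∷ τ) at m
at-++-∷ []      τ s s′ {zero}  m≢0 = ⊥-elim (m≢0 refl)
at-++-∷ []      τ s s′ {suc m} _   = refl
at-++-∷ (_ ∷ σ) τ s s′ {zero}  _   = refl
at-++-∷ (_ ∷ σ) τ s s′ {suc m} m≢  = at-++-∷ σ τ s s′ (m≢ ∘ cong suc)

avoid-two : ∀ {d} → 3 ≤ d → (a b : Fin d) → ∃ λ k → k ≢ a × k ≢ b
avoid-two (s≤s (s≤s (s≤s _))) a b with zero ≟ a | zero ≟ b
... | no 0≢a   | no 0≢b = zero , 0≢a , 0≢b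
... | yes refl | _ with suc zero ≟ b
...   | no 1≢b   = suc zero , (λ ()) , 1≢b
...   | yes refl = suc (suc zero) , (λ ()) , (λ ())
avoid-two (s≤s (s≤s (s≤s _))) a b | no _ | yes refl with suc zero ≟ a
...   | no 1≢a   = suc zero , 1≢a , (λ ())
...   | yes refl = suc (suc zero) , (λ ()) , (λ ())

module Product {d : ℕ} (G : Fin d → Factor) where
  open Prod G

  -- Blocks and vertices of G are handled as functions on Fin d; tuple gives back the list form.
  tuple : ∀ {A : Set} → (Fin d → A) → List A
  tuple f = map f (allFin d)

  IsBlockᶠ : (Fin d → List ℕ) → Set
  IsBlockᶠ g = ∀ k → g k ∈ parts (G k)

  _∈ᶠ_ : (Fin d → ℕ) → (Fin d → List ℕ) → Set
  h ∈ᶠ g = ∀ k → h k ∈ g k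

  rank : Fin d → ℕ → ℕ
  rank k = indexOf (ord (G k))

  startRank : Fin d → ℕ → ℕ
  startRank k x = rank k (headD (partOf (parts (G k)) x))

  blockRanks : (Fin d → List ℕ) → List ℕ
  blockRanks g = tuple (λ k → rank k (headD (g k)))

  blockStart : Sub → List ℕ → List ℕ
  blockStart S x = start (blockOf (idx S) x)

  blockKey : Sub → List ℕ → List ℕ
  blockKey S x = ranks (idx S) (blockStart S x)

  idx-full : idx full ≡ allFin d
  idx-full = filter-all (T? ∘ full) (All.universal _ (allFin d))

  ranks-map : ∀ is (h : Fin d → ℕ) → ranks is (map h is) ≡ map (λ k → rank k (h k)) is
  ranks-map []       h = refl
  ranks-map (k ∷ is) h = cong (_ ∷_) (ranks-map is h)

  blockKey-map : ∀ is (h : Fin d → ℕ) →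
    ranks is (start (blockOf is (map h is))) ≡ map (λ k → startRank k (h k)) is
  blockKey-map []       h = refl
  blockKey-map (k ∷ is) h = cong (_ ∷_) (blockKey-map is h)

  merge-map : ∀ is S (h : Fin d → ℕ) →
    merge is S (map h (filterᵇ S is)) (map h (filterᵇ (not ∘ S) is)) ≡ map h is
  merge-map []       S h = refl
  merge-map (k ∷ is) S h with S k
  ... | true  = cong (h k ∷_) (merge-map is S h)
  ... | false = cong (h k ∷_) (merge-map is S h)

  start-∈-cart : ∀ {is B} → IsBlock is B → start B ∈ cart B
  start-∈-cart []                   = here refl
  start-∈-cart {i ∷ _} (P∈ps ∷ ib) = ∈-cartesianProductWith⁺ _∷_ (headD-∈-part (G i) P∈ps) (start-∈-cart ib)

  blockOf-cart : ∀ {is B v} → IsBlock is B → v ∈ cart B → blockOf is v ≡ B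
  blockOf-cart []          (here refl) = refl
  blockOf-cart {i ∷ _} {P ∷ B} (P∈ps ∷ ib) v∈
    with x , xs , x∈P , xs∈ , refl ← ∈-cartesianProductWith⁻ _∷_ P (cart B) v∈
    = cong₂ _∷_ (partOf-part (G i) P∈ps x∈P) (blockOf-cart ib xs∈)

  module _ (π : DomMap) (S : Sub) where

    blockKey-<⇒BLlt : ∀ {x y} → lexLt (blockKey S x) (blockKey S y) ≡ true → BLlt π S x y ≡ true
    blockKey-<⇒BLlt {x} {y} x<y with ≡-dec ℕ._≟_ (blockStart S x) (blockStart S y)
    ... | yes same = ⊥-elim (lexLt⇒≢ x<y (cong (ranks (idx S)) same))
    ... | no _     = x<y

    BLlt⇒blockKey-≤ : ∀ {x y} → BLlt π S x y ≡ true →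
      blockKey S x ≡ blockKey S y ⊎ lexLt (blockKey S x) (blockKey S y) ≡ true
    BLlt⇒blockKey-≤ {x} {y} x<y with ≡-dec ℕ._≟_ (blockStart S x) (blockStart S y)
    ... | yes same = inj₁ (cong (ranks (idx S)) same)
    ... | no _     = inj₂ x<y

    BLlt-upward : ∀ {u y y′} → lexLt (blockKey S y) (blockKey S y′) ≡ true →
      BLlt π S u y ≡ true → BLlt π S u y′ ≡ true
    BLlt-upward {u} {y} {y′} y<y′ u<y with BLlt⇒blockKey-≤ u<y
    ... | inj₁ u≈y  = blockKey-<⇒BLlt (subst (λ k → lexLt k (blockKey S y′) ≡ true) (sym u≈y) y<y′)
    ... | inj₂ u<y′ = blockKey-<⇒BLlt (lexLt-trans (blockKey S u) _ _ u<y′ y<y′)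

    BLlt-fixed⇒blockKey-< : ∀ {x y} → blockStart S x ≡ x → blockStart S y ≡ y →
      BLlt π S x y ≡ true → lexLt (blockKey S x) (blockKey S y) ≡ true
    BLlt-fixed⇒blockKey-< {x} {y} x-fixed y-fixed x<y with ≡-dec ℕ._≟_ (blockStart S x) (blockStart S y)
    ... | no _     = x<y
    ... | yes same =
      ⊥-elim (lexLt⇒≢ x<y (cong (key S (π S (blockOf (idx S) x))) (trans (sym x-fixed) (trans same y-fixed))))

  startRanks-block : ∀ {g h} → IsBlockᶠ g → h ∈ᶠ g → tuple (λ k → startRank k (h k)) ≡ blockRanks g
  startRanks-block g-block h∈g =
    map-cong (λ k → cong (λ P → rank k (headD P)) (partOf-part (G k) (g-block k) (h∈g k))) (allFin d)

  module _ (π : DomMap) {A : List ℕ → Bool} (compressed : StronglyCompressed π A) where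

    section-downward : ∀ {S} → NonemptyProper S → ∀ {x y y′} →
      x ∈ verts (idx (not ∘ S)) → y ∈ verts (idx S) → y′ ∈ verts (idx S) →
      lexLt (blockKey S y) (blockKey S y′) ≡ true →
      A (merge (allFin d) S y′ x) ≡ true → A (merge (allFin d) S y x) ≡ true
    section-downward {S} proper {x} {y} {y′} x∈ y∈ y′∈ y<y′ Ay′ =
      Equivalence.to T-≡ (proj₂ (∈-filter⁻ (T? ∘ inA) {xs = verts (idx S)} y∈section))
      where
      inA : List ℕ → Bool
      inA y = A (merge (allFin d) S y x)
      size : ℕ
      size = length (filterᵇ inA (verts (idx S)))
      section : filterᵇ inA (verts (idx S)) ≡ initSeg (BLlt π S) (verts (idx S)) size
      section = compressed S proper x x∈
      y′∈section : y′ ∈ filterᵇ inA (verts (idx S))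
      y′∈section = ∈-filter⁺ (T? ∘ inA) y′∈ (Equivalence.from T-≡ Ay′)
      y∈section : y ∈ filterᵇ inA (verts (idx S))
      y∈section = subst (y ∈_) (sym section)
        (initSeg-downward (BLlt π S) (verts (idx S)) size (λ _ → BLlt-upward π S y<y′) y∈
          (subst (y′ ∈_) section y′∈section))

    block-downward : ∀ {S} → NonemptyProper S → ∀ {g g′ h h′} → IsBlockᶠ g → IsBlockᶠ g′ →
      lexLt (blockRanks g) (blockRanks g′) ≡ true → h ∈ᶠ g → h′ ∈ᶠ g′ →
      (∀ k → S k ≡ false → h k ≡ h′ k) → A (tuple h′) ≡ true → A (tuple h) ≡ true
    block-downward {S} proper {g} {g′} {h} {h′} g-block g′-block g<g′ h∈g h′∈g′ agree Ah′ =
      subst (λ v → A v ≡ true) (merge-map (allFin d) S h)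
        (section-downward proper (map-∈-cart vertex (idx (not ∘ S))) (map-∈-cart vertex (idx S))
          (map-∈-cart vertex′ (idx S)) key<
          (subst (λ v → A v ≡ true) (sym merge′) Ah′))
      where
      vertex : ∀ k → h k ∈ upTo (n (G k))
      vertex k = part-⊆-vertices (G k) (g-block k) (h∈g k)
      vertex′ : ∀ k → h′ k ∈ upTo (n (G k))
      vertex′ k = part-⊆-vertices (G k) (g′-block k) (h′∈g′ k)
      complements-agree : map h (idx (not ∘ S)) ≡ map h′ (idx (not ∘ S))
      complements-agree = map-cong-local
        (All.map (λ S̄k → agree _ (Equivalence.to T-not-≡ S̄k)) (all-filter (T? ∘ (not ∘ S)) (allFin d)))
      merge′ : merge (allFin d) S (map h′ (idx S)) (map h (idx (not ∘ S))) ≡ tuple h′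
      merge′ = trans (cong (merge (allFin d) S (map h′ (idx S))) complements-agree) (merge-map (allFin d) S h′)
      key< : lexLt (blockKey S (map h (idx S))) (blockKey S (map h′ (idx S))) ≡ true
      key< = subst₂ (λ a b → lexLt a b ≡ true) (sym (blockKey-map (idx S) h)) (sym (blockKey-map (idx S) h′))
               (lexLt-filterᵇ S _ _ (allFin d) (λ k Sk → cong (startRank k) (agree k Sk))
                 (subst₂ (λ a b → lexLt a b ≡ true)
                    (sym (startRanks-block g-block h∈g)) (sym (startRanks-block g′-block h′∈g′)) g<g′))

    bone-stack-transferᶠ : 3 ≤ d → ∀ {g₁ g₂ g₃} → IsBlockᶠ g₁ → IsBlockᶠ g₂ → IsBlockᶠ g₃ →
      lexLt (blockRanks g₁) (blockRanks g₂) ≡ true → lexLt (blockRanks g₂) (blockRanks g₃) ≡ true →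
      ∀ i₀ → g₁ i₀ ≡ g₂ i₀ → ∀ t → (∀ k → k ≢ t → g₂ k ≡ g₃ k) →
      ∀ {v w} → v ∈ᶠ g₃ → A (tuple v) ≡ true → w ∈ᶠ g₁ → A (tuple w) ≡ true
    bone-stack-transferᶠ 3≤d {g₁} {g₂} {g₃} b₁ b₂ b₃ g₁<g₂ g₂<g₃ i₀ bone t stack {v} {w} v∈g₃ Av w∈g₁ =
      block-downward off-bone-proper b₁ b₂ g₁<g₂ w∈g₁ z∈g₂ w≈z
        (block-downward bone-stack-proper b₂ b₃ g₂<g₃ z∈g₂ v∈g₃ z≈v Av)
      where
      k₀ : Fin d
      k₀ = proj₁ (avoid-two 3≤d i₀ t)
      k₀≢i₀ : k₀ ≢ i₀
      k₀≢i₀ = proj₁ (proj₂ (avoid-two 3≤d i₀ t))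
      k₀≢t : k₀ ≢ t
      k₀≢t = proj₂ (proj₂ (avoid-two 3≤d i₀ t))

      bone-stack : Sub
      bone-stack = pair i₀ t
      bone-stack-proper : NonemptyProper bone-stack
      bone-stack-proper = (i₀ , cong (_∨ does (i₀ ≟ t)) (dec-true (i₀ ≟ i₀) refl))
                        , (k₀ , cong₂ _∨_ (dec-false (k₀ ≟ i₀) k₀≢i₀) (dec-false (k₀ ≟ t) k₀≢t))

      off-bone : Sub
      off-bone k = not (does (k ≟ i₀))
      off-bone-proper : NonemptyProper off-bone
      off-bone-proper = (k₀ , cong not (dec-false (k₀ ≟ i₀) k₀≢i₀)) , (i₀ , cong not (dec-true (i₀ ≟ i₀) refl))

      z : Fin d → ℕ
      z k with k ≟ i₀ | k ≟ t
      ... | yes _ | _     = w i₀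
      ... | no _  | yes _ = headD (g₂ t)
      ... | no _  | no _  = v k

      z∈g₂ : z ∈ᶠ g₂
      z∈g₂ k with k ≟ i₀ | k ≟ t
      ... | yes refl | _        = subst (w i₀ ∈_) bone (w∈g₁ i₀)
      ... | no _     | yes refl = headD-∈-part (G t) (b₂ t)
      ... | no _     | no k≢t   = subst (v k ∈_) (sym (stack k k≢t)) (v∈g₃ k)

      z≈v : ∀ k → bone-stack k ≡ false → z k ≡ v k
      z≈v k off with k ≟ i₀ | k ≟ t
      ... | no _ | no _ = refl

      w≈z : ∀ k → off-bone k ≡ false → w k ≡ z k
      w≈z k on with k ≟ i₀ | k ≟ t
      ... | yes refl | _ = refl

  length-tuple : ∀ {A : Set} (f : Fin d → A) → length (tuple f) ≡ d
  length-tuple f = trans (length-map f (allFin d)) (length-tabulate id)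

  at-tuple : ∀ {A : Set} (f : Fin d → A) k → tuple f at toℕ k ≡ just (f k)
  at-tuple f k = trans (cong (_at toℕ k) (map-tabulate id f)) (at-tabulate f k)

  start-tuple : ∀ g → start (tuple g) ≡ tuple (headD ∘ g)
  start-tuple g = sym (map-∘ (allFin d))

  block-tuple : ∀ {B} → IsBlock (idx full) B → ∃ λ g → B ≡ tuple g × IsBlockᶠ g
  block-tuple ib with g , refl , g-block ← Pointwise-tabulate⁻ id (subst (λ is → IsBlock is _) idx-full ib)
    = g , sym (map-tabulate id g) , g-block

  vertex-tuple : ∀ {g v} → v ∈ cart (tuple g) → ∃ λ h → v ≡ tuple h × h ∈ᶠ g
  vertex-tuple {g} v∈ with h , refl , h∈g ← cart-tabulate⁻ g (subst (λ B → _ ∈ cart B) (map-tabulate id g) v∈)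
    = h , sym (map-tabulate id h) , h∈g

  start-fixed : ∀ {B} → IsBlock (idx full) B → blockStart full (start B) ≡ start B
  start-fixed ib = cong start (blockOf-cart ib (start-∈-cart ib))

  blockKey-start : ∀ {g} → IsBlock (idx full) (tuple g) → blockKey full (start (tuple g)) ≡ blockRanks g
  blockKey-start {g} ib = begin
    ranks (idx full) (blockStart full (start (tuple g))) ≡⟨ cong (ranks (idx full)) (start-fixed ib) ⟩
    ranks (idx full) (start (tuple g))                   ≡⟨ cong (ranks (idx full)) (start-tuple g) ⟩
    ranks (idx full) (tuple (headD ∘ g))                 ≡⟨ cong (λ is → ranks is (tuple (headD ∘ g))) idx-full ⟩
    ranks (allFin d) (tuple (headD ∘ g))                 ≡⟨ ranks-map (allFin d) (headD ∘ g) ⟩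
    blockRanks g                                         ∎
    where open ≡-Reasoning

  BlockLt⇒blockRanks-< : ∀ π {g g′} → IsBlock (idx full) (tuple g) → IsBlock (idx full) (tuple g′) →
    BlockLt π (tuple g) (tuple g′) → lexLt (blockRanks g) (blockRanks g′) ≡ true
  BlockLt⇒blockRanks-< π ib ib′ g<g′ =
    subst₂ (λ a b → lexLt a b ≡ true) (blockKey-start ib) (blockKey-start ib′)
      (BLlt-fixed⇒blockKey-< π full (start-fixed ib) (start-fixed ib′) g<g′)

  ShareBone⇒shared-part : ∀ {g₁ g₂} → ShareBone (tuple g₁) (tuple g₂) → ∃ λ i₀ → g₁ i₀ ≡ g₂ i₀
  ShareBone⇒shared-part {g₁} {g₂} (_ , i₀ , same) =
    i₀ , just-injective (trans (sym (at-tuple g₁ i₀)) (trans same (at-tuple g₂ i₀)))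

  InStack⇒start : ∀ {i σ τ B v} → IsBlock (idx full) B → v ∈ cart B → InStack i σ τ v →
    ∃ λ s → start B ≡ σ ++ s ∷ τ
  InStack⇒start ib v∈B (B′ , ib′ , (s , _ , B′-start) , v∈B′) =
    s , trans (cong start (trans (sym (blockOf-cart ib v∈B)) (blockOf-cart ib′ v∈B′))) B′-start

  stack-blocks-agree : ∀ {σ τ s s′ g g′} → IsBlockᶠ g → IsBlockᶠ g′ →
    start (tuple g) ≡ σ ++ s ∷ τ → start (tuple g′) ≡ σ ++ s′ ∷ τ →
    ∃ λ t → ∀ k → k ≢ t → g k ≡ g′ k
  stack-blocks-agree {σ} {τ} {s} {s′} {g} {g′} g-block g′-block g-start g′-start = fromℕ< σ<d , agree
    where
    σ<d : length σ < d
    σ<d = begin-strict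
      length σ                  <⟨ m<m+n (length σ) z<s ⟩
      length σ + length (s ∷ τ) ≡⟨ sym (length-++ σ) ⟩
      length (σ ++ s ∷ τ)       ≡⟨ cong length (sym g-start) ⟩
      length (start (tuple g))  ≡⟨ length-map headD (tuple g) ⟩
      length (tuple g)          ≡⟨ length-tuple g ⟩
      d                         ∎
      where open ≤-Reasoning hiding (start)
    starts-agree : ∀ k → toℕ k ≢ length σ → headD (g k) ≡ headD (g′ k)
    starts-agree k k≢σ = just-injective (begin
      just (headD (g k))          ≡⟨ sym (at-tuple (headD ∘ g) k) ⟩
      tuple (headD ∘ g) at toℕ k  ≡⟨ cong (_at toℕ k) (trans (sym (start-tuple g)) g-start) ⟩
      (σ ++ s ∷ τ) at toℕ k       ≡⟨ at-++-∷ σ τ s s′ k≢σ ⟩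
      (σ ++ s′ ∷ τ) at toℕ k      ≡⟨ cong (_at toℕ k) (trans (sym g′-start) (start-tuple g′)) ⟩
      tuple (headD ∘ g′) at toℕ k ≡⟨ at-tuple (headD ∘ g′) k ⟩
      just (headD (g′ k))         ∎)
      where open ≡-Reasoning
    agree : ∀ k → k ≢ fromℕ< σ<d → g k ≡ g′ k
    agree k k≢t = begin
      g k                                   ≡⟨ sym (partOf-part (G k) (g-block k) (headD-∈-part (G k) (g-block k))) ⟩
      partOf (parts (G k)) (headD (g k))    ≡⟨ cong (partOf (parts (G k))) (starts-agree k toℕk≢σ) ⟩
      partOf (parts (G k)) (headD (g′ k))   ≡⟨ partOf-part (G k) (g′-block k) (headD-∈-part (G k) (g′-block k)) ⟩
      g′ k                                  ∎
      where
      open ≡-Reasoning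
      toℕk≢σ : toℕ k ≢ length σ
      toℕk≢σ eq = k≢t (toℕ-injective (trans eq (sym (toℕ-fromℕ< σ<d))))

  bone-stack-transfer : ∀ π {A} → StronglyCompressed π A → 3 ≤ d →
    ∀ {B₁ B₂ B₃ i σ τ} → IsBlock (idx full) B₁ → IsBlock (idx full) B₂ → IsBlock (idx full) B₃ →
    BlockLt π B₁ B₂ → BlockLt π B₂ B₃ → ShareBone B₁ B₂ →
    (∀ {v} → v ∈ cart B₂ → InStack i σ τ v) → (∀ {v} → v ∈ cart B₃ → InStack i σ τ v) →
    ∀ {v} → v ∈ cart B₃ → A v ≡ true → ∀ {w} → w ∈ cart B₁ → A w ≡ true
  bone-stack-transfer π {A} compressed 3≤d ib₁ ib₂ ib₃ B₁<B₂ B₂<B₃ bone B₂-stacked B₃-stacked v∈B₃ Av w∈B₁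
    with g₁ , refl , b₁ ← block-tuple ib₁
       | g₂ , refl , b₂ ← block-tuple ib₂
       | g₃ , refl , b₃ ← block-tuple ib₃
    with h , refl , h∈g₃ ← vertex-tuple v∈B₃
       | h′ , refl , h′∈g₁ ← vertex-tuple w∈B₁
    with i₀ , shared ← ShareBone⇒shared-part bone
       | s₂ , start₂ ← InStack⇒start ib₂ (start-∈-cart ib₂) (B₂-stacked (start-∈-cart ib₂))
       | s₃ , start₃ ← InStack⇒start ib₃ (start-∈-cart ib₃) (B₃-stacked (start-∈-cart ib₃))
    with t , stack ← stack-blocks-agree b₂ b₃ start₂ start₃
    = bone-stack-transferᶠ π {A} compressed 3≤d b₁ b₂ b₃
        (BlockLt⇒blockRanks-< π ib₁ ib₂ B₁<B₂) (BlockLt⇒blockRanks-< π ib₂ ib₃ B₂<B₃)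
        i₀ shared t stack h∈g₃ Av h′∈g₁

corollary3 : ∀ {d : ℕ} (G : Fin d → Factor) (π : Prod.DomMap G) →
    3 ≤ d →
    Prod.RegularDomination G π →
    (∀ i → toℕ i ≤ d ∸ 2 → NonDecreasing (G i)) →
    Prod.BL2Optimal G π →
    (A : List ℕ → Bool) → Prod.StronglyCompressed G π A →
    ∀ B₁ B₂ → Prod.IsBlock G (Prod.idx G (Prod.full G)) B₁ → Prod.IsBlock G (Prod.idx G (Prod.full G)) B₂ →
    Prod.BlockLt G π B₁ B₂ → Prod.ShareBone G B₁ B₂ →
    ∀ i σ τ → Prod.StackIndex G i σ τ →
    (∀ {v} → v ∈ cart B₂ → Prod.InStack G i σ τ v) →
    ∀ B₃ → Prod.IsBlock G (Prod.idx G (Prod.full G)) B₃ →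
    (∀ {v} → v ∈ cart B₃ → Prod.InStack G i σ τ v) →
    Prod.BlockLt G π B₂ B₃ →
    ¬ (∀ {v} → v ∈ cart B₁ → A v ≡ true) →
    (∃ λ v → v ∈ cart B₂ × A v ≡ true) →
    ∀ {v} → v ∈ cart B₃ → A v ≡ false
corollary3 G π 3≤d _ _ _ A compressed B₁ B₂ ib₁ ib₂ B₁<B₂ bone i σ τ _ B₂-stacked B₃ ib₃ B₃-stacked B₂<B₃
           B₁⊈A _ {v} v∈B₃ with A v in Av
... | false = refl
... | true  = ⊥-elim (B₁⊈A (Product.bone-stack-transfer G π compressed 3≤d ib₁ ib₂ ib₃ B₁<B₂ B₂<B₃ bone
                               B₂-stacked B₃-stacked v∈B₃ Av))
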